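{- Let $G=(V,E)$ be a finite graph and suppose there is $X\subseteq V$ such that (1) $X$ is a sieve; (2) the induced subgraph $G[X]$ has no non-trivial automorphism; (3) there is no set $X'\subseteq V$ with $X'\ne X$ and $G[X']\cong G[X]$. Then $D_0(G)\le|X|+2$.
   Context: For $X\subseteq V$, $X$ is a sieve in $G$ if no two distinct vertices of $V\setminus X$ have the same set of neighbours in $X$. First order sentences about graphs use variables over vertices, relations $=$ and $\sim$ (adjacency), quantifiers $\forall,\exists$, Boolean connectives; quantifier depth is the maximum number of nested quantifiers. A sentence $A$ defines $G$ if $G\models A$ and $H\not\models A$ for all $H\not\cong G$. For a sentence with no quantifier in the scope of a negation, the alternation number is the maximum number of changes between $\exists$ and $\forall$ along a chain of nested quantifiers. $D_0(G)$ is the minimum depth of a sentence with alternation number $0$ defining $G$. -}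

module Defs where

open import Data.Nat using (ℕ; zero; suc; _+_; _⊔_; _≤_)
open import Data.Bool using (Bool; true; false; T)
open import Data.Fin using (Fin; zero; suc)
open import Data.Fin.Subset using (Subset; _∈_; _∉_; ∣_∣)
open import Data.Product using (Σ; _×_; _,_; proj₁; ∃)
open import Data.Sum using (_⊎_)
open import Data.Empty using (⊥)
open import Data.Unit using (⊤)
open import Data.Maybe using (Maybe; just; nothing)
open import Relation.Nullary using (¬_)
open import Relation.Binary.PropositionalEquality using (_≡_; _≢_)
open import Function.Bundles using (_⤖_; Bijection)

record Graph : Set where
  field
    n     : ℕ
    adj   : Fin n → Fin n → Bool
    sym   : ∀ u v → adj u v ≡ adj v u
    irref : ∀ v → adj v v ≡ false
open Graph public

_≅_ : Graph → Graph → Set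
G ≅ H = Σ (Fin (n G) ⤖ Fin (n H)) λ f →
  ∀ u v → adj G u v ≡ adj H (Bijection.to f u) (Bijection.to f v)

-- Induced subgraphs G[X]: vertex set is the elements of X, adjacency inherited

Vert : (G : Graph) → Subset (n G) → Set
Vert G X = Σ (Fin (n G)) (λ v → v ∈ X)

InducedIso : (G : Graph) → Subset (n G) → Subset (n G) → Set
InducedIso G X Y = Σ (Vert G X ⤖ Vert G Y) λ f →
  ∀ u v → adj G (proj₁ u) (proj₁ v)
        ≡ adj G (proj₁ (Bijection.to f u)) (proj₁ (Bijection.to f v))

Automorphism : (G : Graph) → Subset (n G) → Set
Automorphism G X = InducedIso G X X

NonTrivial : (G : Graph) (X : Subset (n G)) → Automorphism G X → Set
NonTrivial G X (f , _) = Σ (Vert G X) λ v → proj₁ (Bijection.to f v) ≢ proj₁ v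

IsSieve : (G : Graph) → Subset (n G) → Set
IsSieve G X = ∀ u v → u ∉ X → v ∉ X →
  (∀ x → x ∈ X → adj G u x ≡ adj G v x) → u ≡ v

data Formula (k : ℕ) : Set where
  _≐_  : Fin k → Fin k → Formula k
  _∼_  : Fin k → Fin k → Formula k
  ¬'_  : Formula k → Formula k
  _∧'_ : Formula k → Formula k → Formula k
  _∨'_ : Formula k → Formula k → Formula k
  ∃'   : Formula (suc k) → Formula k
  ∀'   : Formula (suc k) → Formula k

Sentence : Set
Sentence = Formula 0

depth : ∀ {k} → Formula k → ℕ
depth (x ≐ y) = 0
depth (x ∼ y) = 0
depth (¬' φ) = depth φ
depth (φ ∧' ψ) = depth φ ⊔ depth ψ
depth (φ ∨' ψ) = depth φ ⊔ depth ψ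
depth (∃' φ) = suc (depth φ)
depth (∀' φ) = suc (depth φ)

QF : ∀ {k} → Formula k → Set
QF (x ≐ y) = ⊤
QF (x ∼ y) = ⊤
QF (¬' φ) = QF φ
QF (φ ∧' ψ) = QF φ × QF ψ
QF (φ ∨' ψ) = QF φ × QF ψ
QF (∃' φ) = ⊥
QF (∀' φ) = ⊥

NegQF : ∀ {k} → Formula k → Set
NegQF (x ≐ y) = ⊤
NegQF (x ∼ y) = ⊤
NegQF (¬' φ) = QF φ
NegQF (φ ∧' ψ) = NegQF φ × NegQF ψ
NegQF (φ ∨' ψ) = NegQF φ × NegQF ψ
NegQF (∃' φ) = NegQF φ
NegQF (∀' φ) = NegQF φ

data Quant : Set where
  qex qall : Quant

change : Maybe Quant → Quant → ℕ
change nothing _ = 0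
change (just qex) qex = 0
change (just qall) qall = 0
change (just qex) qall = 1
change (just qall) qex = 1

altFrom : ∀ {k} → Maybe Quant → Formula k → ℕ
altFrom m (x ≐ y) = 0
altFrom m (x ∼ y) = 0
altFrom m (¬' φ) = altFrom m φ
altFrom m (φ ∧' ψ) = altFrom m φ ⊔ altFrom m ψ
altFrom m (φ ∨' ψ) = altFrom m φ ⊔ altFrom m ψ
altFrom m (∃' φ) = change m qex + altFrom (just qex) φ
altFrom m (∀' φ) = change m qall + altFrom (just qall) φ

alternation : ∀ {k} → Formula k → ℕ
alternation = altFrom nothing

extend : ∀ {A : Set} {k} → A → (Fin k → A) → Fin (suc k) → A
extend a ρ zero = a
extend a ρ (suc i) = ρ i

Sat : (G : Graph) → ∀ {k} → (Fin k → Fin (n G)) → Formula k → Set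
Sat G ρ (x ≐ y) = ρ x ≡ ρ y
Sat G ρ (x ∼ y) = T (adj G (ρ x) (ρ y))
Sat G ρ (¬' φ) = ¬ Sat G ρ φ
Sat G ρ (φ ∧' ψ) = Sat G ρ φ × Sat G ρ ψ
Sat G ρ (φ ∨' ψ) = Sat G ρ φ ⊎ Sat G ρ ψ
Sat G ρ (∃' φ) = Σ (Fin (n G)) λ v → Sat G (extend v ρ) φ
Sat G ρ (∀' φ) = (v : Fin (n G)) → Sat G (extend v ρ) φ

_⊨_ : Graph → Sentence → Set
G ⊨ A = Sat G (λ ()) A

Defines : Sentence → Graph → Set
Defines A G = G ⊨ A × (∀ H → ¬ (H ≅ G) → ¬ (H ⊨ A))

-- D₀(G) ≤ d : some sentence with no quantifier under a negation and
-- alternation number 0, of depth ≤ d, defines G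
-- (equivalent to the minimum depth D₀(G) being ≤ d)
D₀≤ : Graph → ℕ → Set
D₀≤ G d = Σ Sentence λ A →
  NegQF A × alternation A ≡ 0 × depth A ≤ d × Defines A G

{-# OPTIONS --safe #-}
module Submission where

-- Let e enumerate X and write tp_σ for the quantifier-free formula fixing the
-- atomic type of a tuple σ of vertices of G. The defining sentence is U ∧ E with
--   U = ∀x̄ ∀y ∀z (tp_e(x̄) → ⋁_{a,b} tp_{e a b}(x̄ y z)),   E = ∃x̄ ⋀_w ∃z tp_{e w}(x̄ z).
-- In G a tuple of the atomic type of e enumerates an induced copy of G[X]; by
-- uniqueness of that copy and rigidity of G[X] it is e itself, so G ⊨ U.
-- Conversely, if H ⊨ U ∧ E and x̄ witnesses E, then U sends each vertex y of H to
-- a vertex f y of G with the same type over e as y has over x̄. Since X is a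
-- sieve, a vertex of G is determined by its type over e; so f is well defined,
-- E makes it surjective, and U applied to pairs makes it injective and
-- adjacency-preserving.

open import Defs hiding (sym)
open import Data.Bool using (true; false; T)
open import Data.Bool.Properties using (T-≡; ⇔→≡) renaming (_≟_ to _≟ᵇ_)
open import Data.Empty using (⊥-elim)
open import Data.Fin using (Fin; zero; suc; _≟_)
open import Data.Fin.Properties using (any?)
open import Data.Fin.Subset using (Subset; _∈_; ∣_∣)
open import Data.Fin.Subset.Properties using (_∈?_)
open import Data.Maybe using (just; nothing)
open import Data.Nat using (ℕ; zero; suc; _+_; _⊔_; _≤_; s≤s)
open import Data.Nat.Properties
  using (+-suc; +-comm; +-identityʳ; ⊔-lub; ≤-reflexive; +-monoʳ-≤; m≤n⇒m≤1+n)
open import Data.Product using (Σ; ∃; ∃₂; _×_; _,_; proj₁; proj₂)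
open import Data.Product.Function.NonDependent.Propositional using (_×-⇔_)
open import Data.Sum using (_⊎_; inj₁; inj₂; [_,_])
open import Data.Unit using (tt)
open import Data.Vec using (_∷_; here; there; tabulate)
open import Data.Vec.Properties using (lookup∘tabulate; []=⇒lookup; lookup⇒[]=; ≡-dec)
open import Data.Vec.Properties.WithK using ([]=-irrelevant)
open import Function using (_∘_; id; case_of_)
open import Function.Bundles using (_⇔_; mk⇔; Equivalence; Bijection; mk↔ₛ′)
open import Function.Properties.Equivalence using () renaming (sym to ⇔-sym; trans to ⇔-trans)
open import Function.Properties.Inverse using (↔⇒⤖)
open import Relation.Nullary using (¬_; Dec; yes; no)
open import Relation.Nullary.Decidable using (T?; ¬?; _×-dec_; _⊎-dec_; isYes; toWitness; fromWitness)
open import Relation.Binary.PropositionalEquality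
  using (_≡_; _≢_; _≗_; refl; sym; trans; cong; cong₂; subst; subst₂; module ≡-Reasoning)

open Equivalence using (to; from)

inhabited? : ∀ m → Dec (Fin m)
inhabited? zero = no λ ()
inhabited? (suc m) = yes zero

extend-η : ∀ {A : Set} {m} (τ : Fin (suc m) → A) → extend (τ zero) (τ ∘ suc) ≗ τ
extend-η τ zero = refl
extend-η τ (suc i) = refl

extend-cong : ∀ {A : Set} {k} (a : A) {ρ ρ′ : Fin k → A} → ρ ≗ ρ′ → extend a ρ ≗ extend a ρ′
extend-cong a eq zero = refl
extend-cong a eq (suc i) = eq i

T-⇔-≡ : ∀ {x y} → (T x ⇔ T y) ⇔ (x ≡ y)
T-⇔-≡ = mk⇔ (λ h → ⇔→≡ {z = true} (⇔-trans (⇔-sym T-≡) (⇔-trans h T-≡)))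
             (λ eq → mk⇔ (subst T eq) (subst T (sym eq)))

∀* : ∀ m → Formula m → Sentence
∀* zero φ = φ
∀* (suc m) φ = ∀* m (∀' φ)

∃* : ∀ m → Formula m → Sentence
∃* zero φ = φ
∃* (suc m) φ = ∃* m (∃' φ)

module _ (H : Graph) where

  Sat-cong : ∀ {k} {ρ ρ′ : Fin k → Fin (n H)} → ρ ≗ ρ′ → (φ : Formula k) → Sat H ρ φ → Sat H ρ′ φ
  Sat-cong eq (x ≐ y) s = trans (sym (eq x)) (trans s (eq y))
  Sat-cong eq (x ∼ y) = subst₂ (λ u v → T (adj H u v)) (eq x) (eq y)
  Sat-cong eq (¬' φ) s t = s (Sat-cong (sym ∘ eq) φ t)
  Sat-cong eq (φ ∧' ψ) (s , t) = Sat-cong eq φ s , Sat-cong eq ψ t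
  Sat-cong eq (φ ∨' ψ) (inj₁ s) = inj₁ (Sat-cong eq φ s)
  Sat-cong eq (φ ∨' ψ) (inj₂ s) = inj₂ (Sat-cong eq ψ s)
  Sat-cong eq (∃' φ) (v , s) = v , Sat-cong (extend-cong v eq) φ s
  Sat-cong eq (∀' φ) s v = Sat-cong (extend-cong v eq) φ (s v)

  Sat? : ∀ {k} (ρ : Fin k → Fin (n H)) (φ : Formula k) → QF φ → Dec (Sat H ρ φ)
  Sat? ρ (x ≐ y) _ = ρ x ≟ ρ y
  Sat? ρ (x ∼ y) _ = T? (adj H (ρ x) (ρ y))
  Sat? ρ (¬' φ) q = ¬? (Sat? ρ φ q)
  Sat? ρ (φ ∧' ψ) (p , q) = Sat? ρ φ p ×-dec Sat? ρ ψ q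
  Sat? ρ (φ ∨' ψ) (p , q) = Sat? ρ φ p ⊎-dec Sat? ρ ψ q

  Sat-∀* : ∀ m (φ : Formula m) → H ⊨ ∀* m φ ⇔ (∀ τ → Sat H τ φ)
  Sat-∀* zero φ = mk⇔ (λ s τ → Sat-cong (λ ()) φ s) (λ s → s (λ ()))
  Sat-∀* (suc m) φ = ⇔-trans (Sat-∀* m (∀' φ))
    (mk⇔ (λ s τ → Sat-cong (extend-η τ) φ (s (τ ∘ suc) (τ zero)))
         (λ s τ v → s (extend v τ)))

  Sat-∃* : ∀ m (φ : Formula m) → H ⊨ ∃* m φ ⇔ (∃ λ τ → Sat H τ φ)
  Sat-∃* zero φ = mk⇔ (λ s → (λ ()) , s) (λ (τ , s) → Sat-cong (λ ()) φ s)
  Sat-∃* (suc m) φ = ⇔-trans (Sat-∃* m (∃' φ))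
    (mk⇔ (λ (τ , v , s) → extend v τ , s)
         (λ (τ , s) → τ ∘ suc , τ zero , Sat-cong (sym ∘ extend-η τ) φ s))

depth-∀* : ∀ m (φ : Formula m) → depth (∀* m φ) ≡ m + depth φ
depth-∀* zero φ = refl
depth-∀* (suc m) φ = trans (depth-∀* m (∀' φ)) (+-suc m (depth φ))

depth-∃* : ∀ m (φ : Formula m) → depth (∃* m φ) ≡ m + depth φ
depth-∃* zero φ = refl
depth-∃* (suc m) φ = trans (depth-∃* m (∃' φ)) (+-suc m (depth φ))

QF⇒depth≡0 : ∀ {k} (φ : Formula k) → QF φ → depth φ ≡ 0
QF⇒depth≡0 (x ≐ y) _ = refl
QF⇒depth≡0 (x ∼ y) _ = refl
QF⇒depth≡0 (¬' φ) q = QF⇒depth≡0 φ q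
QF⇒depth≡0 (φ ∧' ψ) (p , q) = cong₂ _⊔_ (QF⇒depth≡0 φ p) (QF⇒depth≡0 ψ q)
QF⇒depth≡0 (φ ∨' ψ) (p , q) = cong₂ _⊔_ (QF⇒depth≡0 φ p) (QF⇒depth≡0 ψ q)

QF⇒NegQF : ∀ {k} (φ : Formula k) → QF φ → NegQF φ
QF⇒NegQF (x ≐ y) _ = tt
QF⇒NegQF (x ∼ y) _ = tt
QF⇒NegQF (¬' φ) q = q
QF⇒NegQF (φ ∧' ψ) (p , q) = QF⇒NegQF φ p , QF⇒NegQF ψ q
QF⇒NegQF (φ ∨' ψ) (p , q) = QF⇒NegQF φ p , QF⇒NegQF ψ q

QF⇒altFrom≡0 : ∀ {k} m (φ : Formula k) → QF φ → altFrom m φ ≡ 0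
QF⇒altFrom≡0 m (x ≐ y) _ = refl
QF⇒altFrom≡0 m (x ∼ y) _ = refl
QF⇒altFrom≡0 m (¬' φ) q = QF⇒altFrom≡0 m φ q
QF⇒altFrom≡0 m (φ ∧' ψ) (p , q) = cong₂ _⊔_ (QF⇒altFrom≡0 m φ p) (QF⇒altFrom≡0 m ψ q)
QF⇒altFrom≡0 m (φ ∨' ψ) (p , q) = cong₂ _⊔_ (QF⇒altFrom≡0 m φ p) (QF⇒altFrom≡0 m ψ q)

data Monoquantified : Quant → ∀ {k} → Formula k → Set where
  qf   : ∀ {q k} {φ : Formula k} → QF φ → Monoquantified q φ
  conj : ∀ {q k} {φ ψ : Formula k} → Monoquantified q φ → Monoquantified q ψ → Monoquantified q (φ ∧' ψ)
  disj : ∀ {q k} {φ ψ : Formula k} → Monoquantified q φ → Monoquantified q ψ → Monoquantified q (φ ∨' ψ)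
  ex   : ∀ {k} {φ : Formula (suc k)} → Monoquantified qex φ → Monoquantified qex (∃' φ)
  all  : ∀ {k} {φ : Formula (suc k)} → Monoquantified qall φ → Monoquantified qall (∀' φ)

Monoquantified⇒NegQF : ∀ {q k} {φ : Formula k} → Monoquantified q φ → NegQF φ
Monoquantified⇒NegQF {φ = φ} (qf p) = QF⇒NegQF φ p
Monoquantified⇒NegQF (conj p q) = Monoquantified⇒NegQF p , Monoquantified⇒NegQF q
Monoquantified⇒NegQF (disj p q) = Monoquantified⇒NegQF p , Monoquantified⇒NegQF q
Monoquantified⇒NegQF (ex p) = Monoquantified⇒NegQF p
Monoquantified⇒NegQF (all p) = Monoquantified⇒NegQF p

Monoquantified⇒altFrom≡0 : ∀ {q k} {φ : Formula k} → Monoquantified q φ →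
                           ∀ m → change m q ≡ 0 → altFrom m φ ≡ 0
Monoquantified⇒altFrom≡0 {φ = φ} (qf p) m _ = QF⇒altFrom≡0 m φ p
Monoquantified⇒altFrom≡0 (conj p q) m c =
  cong₂ _⊔_ (Monoquantified⇒altFrom≡0 p m c) (Monoquantified⇒altFrom≡0 q m c)
Monoquantified⇒altFrom≡0 (disj p q) m c =
  cong₂ _⊔_ (Monoquantified⇒altFrom≡0 p m c) (Monoquantified⇒altFrom≡0 q m c)
Monoquantified⇒altFrom≡0 (ex p) m c = cong₂ _+_ c (Monoquantified⇒altFrom≡0 p (just qex) refl)
Monoquantified⇒altFrom≡0 (all p) m c = cong₂ _+_ c (Monoquantified⇒altFrom≡0 p (just qall) refl)

Monoquantified⇒alternation≡0 : ∀ {q} {A : Sentence} → Monoquantified q A → alternation A ≡ 0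
Monoquantified⇒alternation≡0 p = Monoquantified⇒altFrom≡0 p nothing refl

∀*-universal : ∀ m {φ : Formula m} → Monoquantified qall φ → Monoquantified qall (∀* m φ)
∀*-universal zero p = p
∀*-universal (suc m) p = ∀*-universal m (all p)

∃*-existential : ∀ m {φ : Formula m} → Monoquantified qex φ → Monoquantified qex (∃* m φ)
∃*-existential zero p = p
∃*-existential (suc m) p = ∃*-existential m (ex p)

-- Finite conjunctions and disjunctions need a unit, since no quantifier-free
-- sentence exists.
⋀ : ∀ {c m} → Formula c → (Fin m → Formula c) → Formula c
⋀ {m = zero} unit φs = unit
⋀ {m = suc m} unit φs = φs zero ∧' ⋀ unit (φs ∘ suc)

⋁ : ∀ {c m} → Formula c → (Fin m → Formula c) → Formula c
⋁ {m = zero} unit φs = unit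
⋁ {m = suc m} unit φs = φs zero ∨' ⋁ unit (φs ∘ suc)

⊤' : ∀ {c} → Formula (suc c)
⊤' = zero ≐ zero

⊥' : ∀ {c} → Formula (suc c)
⊥' = ¬' ⊤'

module _ {c} (P : Formula c → Set) where

  ⋀-preserves : (∀ {φ ψ} → P φ → P ψ → P (φ ∧' ψ)) →
                ∀ {m} {unit} {φs : Fin m → Formula c} → P unit → (∀ i → P (φs i)) → P (⋀ unit φs)
  ⋀-preserves P-∧ {zero} p ps = p
  ⋀-preserves P-∧ {suc m} p ps = P-∧ (ps zero) (⋀-preserves P-∧ p (ps ∘ suc))

  ⋁-preserves : (∀ {φ ψ} → P φ → P ψ → P (φ ∨' ψ)) →
                ∀ {m} {unit} {φs : Fin m → Formula c} → P unit → (∀ i → P (φs i)) → P (⋁ unit φs)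
  ⋁-preserves P-∨ {zero} p ps = p
  ⋁-preserves P-∨ {suc m} p ps = P-∨ (ps zero) (⋁-preserves P-∨ p (ps ∘ suc))

module _ (H : Graph) {c} (ρ : Fin c → Fin (n H)) where

  Sat-⋀ : ∀ {m} unit (φs : Fin m → Formula c) →
          Sat H ρ (⋀ unit φs) ⇔ (Sat H ρ unit × ∀ i → Sat H ρ (φs i))
  Sat-⋀ {zero} unit φs = mk⇔ (λ s → s , λ ()) proj₁
  Sat-⋀ {suc m} unit φs = mk⇔
    (λ (s , t) → let (u , ts) = to IH t in u , λ { zero → s ; (suc i) → ts i })
    (λ (u , ss) → ss zero , from IH (u , ss ∘ suc))
    where IH = Sat-⋀ unit (φs ∘ suc)

  Sat-⋁ : ∀ {m} unit (φs : Fin m → Formula c) →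
          Sat H ρ (⋁ unit φs) ⇔ (Sat H ρ unit ⊎ ∃ λ i → Sat H ρ (φs i))
  Sat-⋁ {zero} unit φs = mk⇔ inj₁ [ id , (λ { (() , _) }) ]
  Sat-⋁ {suc m} unit φs = mk⇔
    [ (λ s → inj₂ (zero , s)) , [ inj₁ , (λ (i , s) → inj₂ (suc i , s)) ] ∘ to IH ]
    [ inj₂ ∘ from IH ∘ inj₁ , (λ { (zero , s) → inj₁ s ; (suc i , s) → inj₂ (from IH (inj₂ (i , s))) }) ]
    where IH = Sat-⋁ unit (φs ∘ suc)

Sat-⋁⊥' : ∀ H {c m} (ρ : Fin (suc c) → Fin (n H)) (φs : Fin m → Formula (suc c)) →
          Sat H ρ (⋁ ⊥' φs) ⇔ (∃ λ i → Sat H ρ (φs i))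
Sat-⋁⊥' H ρ φs = ⇔-trans (Sat-⋁ H ρ ⊥' φs) (mk⇔ [ (λ s → ⊥-elim (s refl)) , id ] inj₂)

SameAtomicType : (H G : Graph) {m : ℕ} → (Fin m → Fin (n H)) → (Fin m → Fin (n G)) → Set
SameAtomicType H G ρ σ = ∀ i j → (ρ i ≡ ρ j ⇔ σ i ≡ σ j) × adj H (ρ i) (ρ j) ≡ adj G (σ i) (σ j)

module _ (H G : Graph) {m : ℕ} {ρ : Fin m → Fin (n H)} {σ : Fin m → Fin (n G)} where

  SameAtomicType-sym : SameAtomicType H G ρ σ → SameAtomicType G H σ ρ
  SameAtomicType-sym st i j = ⇔-sym (proj₁ (st i j)) , sym (proj₂ (st i j))

  SameAtomicType-trans : ∀ K {κ : Fin m → Fin (n K)} →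
                         SameAtomicType H G ρ σ → SameAtomicType G K σ κ → SameAtomicType H K ρ κ
  SameAtomicType-trans K st st′ i j =
    ⇔-trans (proj₁ (st i j)) (proj₁ (st′ i j)) , trans (proj₂ (st i j)) (proj₂ (st′ i j))

  SameAtomicType-tail : ∀ {y a} → SameAtomicType H G (extend y ρ) (extend a σ) → SameAtomicType H G ρ σ
  SameAtomicType-tail st i j = st (suc i) (suc j)

  SameAtomicType-drop₁ : ∀ {y z a b} → SameAtomicType H G (extend z (extend y ρ)) (extend b (extend a σ)) →
                         SameAtomicType H G (extend z ρ) (extend b σ)
  SameAtomicType-drop₁ st zero zero = st zero zero
  SameAtomicType-drop₁ st zero (suc j) = st zero (suc (suc j))
  SameAtomicType-drop₁ st (suc i) zero = st (suc (suc i)) zero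
  SameAtomicType-drop₁ st (suc i) (suc j) = st (suc (suc i)) (suc (suc j))

≗⇒SameAtomicType : ∀ G {m} {ρ σ : Fin m → Fin (n G)} → ρ ≗ σ → SameAtomicType G G ρ σ
≗⇒SameAtomicType G eq i j =
  mk⇔ (λ p → trans (sym (eq i)) (trans p (eq j))) (λ p → trans (eq i) (trans p (sym (eq j)))) ,
  cong₂ (adj G) (eq i) (eq j)

lit : ∀ {P : Set} {c} → Dec P → Formula c → Formula c
lit (yes _) φ = φ
lit (no _) φ = ¬' φ

lit-QF : ∀ {P : Set} {c} (P? : Dec P) (φ : Formula c) → QF φ → QF (lit P? φ)
lit-QF (yes _) φ q = q
lit-QF (no _) φ q = q

Sat-lit : ∀ H {P : Set} {c} {ρ : Fin c → Fin (n H)} (P? : Dec P) (φ : Formula c) →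
          Sat H ρ (lit P? φ) ⇔ (Sat H ρ φ ⇔ P)
Sat-lit H (yes p) φ = mk⇔ (λ s → mk⇔ (λ _ → p) (λ _ → s)) (λ h → from h p)
Sat-lit H (no ¬p) φ = mk⇔ (λ s → mk⇔ (⊥-elim ∘ s) (⊥-elim ∘ ¬p)) (λ h → ¬p ∘ to h)

module _ (G : Graph) {m : ℕ} (σ : Fin m → Fin (n G)) where

  atom : ∀ {c} → (Fin m → Fin c) → Fin m → Fin m → Formula c
  atom v i j = lit (σ i ≟ σ j) (v i ≐ v j) ∧' lit (T? (adj G (σ i) (σ j))) (v i ∼ v j)

  tp : ∀ {c} → (Fin m → Fin (suc c)) → Formula (suc c)
  tp v = ⋀ ⊤' λ i → ⋀ ⊤' λ j → atom v i j

  tp-QF : ∀ {c} (v : Fin m → Fin (suc c)) → QF (tp v)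
  tp-QF v = ⋀-preserves QF _,_ tt λ i → ⋀-preserves QF _,_ tt λ j →
    lit-QF (σ i ≟ σ j) (v i ≐ v j) tt , lit-QF (T? (adj G (σ i) (σ j))) (v i ∼ v j) tt

  Sat-tp : ∀ H {c} (ρ : Fin (suc c) → Fin (n H)) v → Sat H ρ (tp v) ⇔ SameAtomicType H G (ρ ∘ v) σ
  Sat-tp H ρ v = mk⇔
    (λ s i j → to (Sat-atom i j) (proj₂ (to (Sat-⋀ H ρ ⊤' _) (proj₂ (to (Sat-⋀ H ρ ⊤' _) s) i)) j))
    (λ st → from (Sat-⋀ H ρ ⊤' _) (refl , λ i → from (Sat-⋀ H ρ ⊤' _) (refl , λ j → from (Sat-atom i j) (st i j))))
    where
    Sat-atom : ∀ i j → Sat H ρ (atom v i j) ⇔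
               ((ρ (v i) ≡ ρ (v j) ⇔ σ i ≡ σ j) × adj H (ρ (v i)) (ρ (v j)) ≡ adj G (σ i) (σ j))
    Sat-atom i j = Sat-lit H (σ i ≟ σ j) (v i ≐ v j) ×-⇔
                   ⇔-trans (Sat-lit H (T? (adj G (σ i) (σ j))) (v i ∼ v j)) T-⇔-≡

enum : ∀ {m} (p : Subset m) → Fin ∣ p ∣ → Fin m
enum (true ∷ p) zero = zero
enum (true ∷ p) (suc i) = suc (enum p i)
enum (false ∷ p) i = suc (enum p i)

Enumerates : ∀ {k m} → (Fin k → Fin m) → Subset m → Set
Enumerates x p = (∀ i → x i ∈ p) × (∀ {v} → v ∈ p → ∃ λ i → x i ≡ v)

enum-enumerates : ∀ {m} (p : Subset m) → Enumerates (enum p) p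
enum-enumerates p = enum-∈ p , enum-onto p
  where
  enum-∈ : ∀ {m} (p : Subset m) i → enum p i ∈ p
  enum-∈ (true ∷ p) zero = here
  enum-∈ (true ∷ p) (suc i) = there (enum-∈ p i)
  enum-∈ (false ∷ p) i = there (enum-∈ p i)

  enum-onto : ∀ {m} (p : Subset m) {v} → v ∈ p → ∃ λ i → enum p i ≡ v
  enum-onto (true ∷ p) here = zero , refl
  enum-onto (true ∷ p) (there v∈p) = let (i , eq) = enum-onto p v∈p in suc i , cong suc eq
  enum-onto (false ∷ p) (there v∈p) = let (i , eq) = enum-onto p v∈p in i , cong suc eq

image : ∀ {k m} → (Fin k → Fin m) → Subset m
image x = tabulate λ v → isYes (any? λ i → x i ≟ v)

image-enumerates : ∀ {k m} (x : Fin k → Fin m) → Enumerates x (image x)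
image-enumerates x =
  (λ i → lookup⇒[]= (x i) (image x)
           (trans (lookup∘tabulate _ (x i)) (to T-≡ (fromWitness (i , refl))))) ,
  (λ {v} v∈ → toWitness (from T-≡ (trans (sym (lookup∘tabulate _ v)) ([]=⇒lookup v∈))))

module _ (G : Graph) where

  Vert-≡ : ∀ {Y} {u v : Vert G Y} → proj₁ u ≡ proj₁ v → u ≡ v
  Vert-≡ {u = v , p} {.v , q} refl = cong (v ,_) ([]=-irrelevant p q)

  transfer : ∀ {k} {x y : Fin k → Fin (n G)} {Y Z : Subset (n G)} →
             Enumerates x Y → Enumerates y Z → Vert G Y → Vert G Z
  transfer {y = y} (_ , x-onto) (y-∈ , _) (v , v∈Y) = y (proj₁ (x-onto v∈Y)) , y-∈ _

  transfer-point : ∀ {k} {x y : Fin k → Fin (n G)} {Y Z : Subset (n G)} →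
                   SameAtomicType G G x y → (x-enum : Enumerates x Y) (y-enum : Enumerates y Z) →
                   ∀ i (p : x i ∈ Y) → proj₁ (transfer x-enum y-enum (x i , p)) ≡ y i
  transfer-point st (_ , x-onto) _ i p = to (proj₁ (st _ i)) (proj₂ (x-onto p))

  transfer-inverse : ∀ {k} {x y : Fin k → Fin (n G)} {Y Z : Subset (n G)} →
                     SameAtomicType G G x y → (x-enum : Enumerates x Y) (y-enum : Enumerates y Z) →
                     ∀ v → transfer y-enum x-enum (transfer x-enum y-enum v) ≡ v
  transfer-inverse st x-enum@(_ , x-onto) y-enum@(y-∈ , _) (v , v∈Y) = Vert-≡ (trans
    (transfer-point (SameAtomicType-sym G G st) y-enum x-enum j (y-∈ j)) (proj₂ (x-onto v∈Y)))
    where j = proj₁ (x-onto v∈Y)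

  enumerations-iso : ∀ {k} {x y : Fin k → Fin (n G)} {Y Z : Subset (n G)} →
                     SameAtomicType G G x y → Enumerates x Y → Enumerates y Z → InducedIso G Y Z
  enumerations-iso st x-enum@(_ , x-onto) y-enum =
    ↔⇒⤖ (mk↔ₛ′ (transfer x-enum y-enum) (transfer y-enum x-enum)
      (transfer-inverse (SameAtomicType-sym G G st) y-enum x-enum) (transfer-inverse st x-enum y-enum)) ,
    λ (u , u∈Y) (v , v∈Y) →
      let (i , xi≡u) = x-onto u∈Y ; (j , xj≡v) = x-onto v∈Y
      in trans (sym (cong₂ (adj G) xi≡u xj≡v)) (proj₂ (st i j))

module _ (G : Graph) (X : Subset (n G)) where

  image-iso : ∀ {x} → SameAtomicType G G x (enum X) → InducedIso G (image x) X
  image-iso {x} st = enumerations-iso G st (image-enumerates x) (enum-enumerates X)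

  module _ (rigid : ¬ Σ (Automorphism G X) (NonTrivial G X)) where

    automorphism-fixes : (f : Automorphism G X) → ∀ v → proj₁ (Bijection.to (proj₁ f) v) ≡ proj₁ v
    automorphism-fixes f v with proj₁ (Bijection.to (proj₁ f) v) ≟ proj₁ v
    ... | yes fixed = fixed
    ... | no moved = ⊥-elim (rigid (f , v , moved))

    iso-onto-fixes : ∀ {Y} → Y ≡ X → (f : InducedIso G Y X) → ∀ v → proj₁ (Bijection.to (proj₁ f) v) ≡ proj₁ v
    iso-onto-fixes refl = automorphism-fixes

    enum-rigid : (∀ X′ → X′ ≢ X → ¬ InducedIso G X′ X) →
                 ∀ {x} → SameAtomicType G G x (enum X) → x ≗ enum X
    enum-rigid unique {x} st i with ≡-dec _≟ᵇ_ (image x) X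
    ... | no image≢X = ⊥-elim (unique (image x) image≢X (image-iso st))
    ... | yes image≡X = begin
      x i                                            ≡⟨ iso-onto-fixes image≡X (image-iso st) xi ⟨
      proj₁ (Bijection.to (proj₁ (image-iso st)) xi) ≡⟨ transfer-point G st x-enum (enum-enumerates X) i (proj₂ xi) ⟩
      enum X i                                       ∎
      where
      open ≡-Reasoning
      x-enum = image-enumerates x
      xi = x i , proj₁ x-enum i

  module _ (sieve : IsSieve G X) where

    private
      e = enum X
      e-onto = proj₂ (enum-enumerates X)

    member-separates : ∀ {a a′} → a ∈ X → SameAtomicType G G (extend a e) (extend a′ e) → a ≡ a′
    member-separates a∈X st = let (i , ei≡a) = e-onto a∈X in
      trans (sym ei≡a) (to (proj₁ (st (suc i) zero)) ei≡a)

    sieve-separates : ∀ {a a′} → SameAtomicType G G (extend a e) (extend a′ e) → a ≡ a′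
    sieve-separates {a} {a′} st with a ∈? X | a′ ∈? X
    ... | yes a∈X | _ = member-separates a∈X st
    ... | no _ | yes a′∈X = sym (member-separates a′∈X (SameAtomicType-sym G G st))
    ... | no a∉X | no a′∉X = sieve a a′ a∉X a′∉X λ v v∈X →
      let (i , ei≡v) = e-onto v∈X in
      subst (λ w → adj G a w ≡ adj G a′ w) ei≡v (proj₂ (st zero (suc i)))

module DefiningSentence (G : Graph) (X : Subset (n G)) where

  k : ℕ
  k = ∣ X ∣

  e : Fin k → Fin (n G)
  e = enum X

  x-vars : Fin k → Fin (2 + k)
  x-vars i = suc (suc i)

  U-matrix : Formula (2 + k)
  U-matrix = (¬' tp G e x-vars) ∨' (⋁ ⊥' λ a → ⋁ ⊥' λ b → tp G (extend b (extend a e)) id)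

  U-matrix-QF : QF U-matrix
  U-matrix-QF = tp-QF G e x-vars ,
    ⋁-preserves QF _,_ tt λ a → ⋁-preserves QF _,_ tt λ b → tp-QF G (extend b (extend a e)) id

  U : Sentence
  U = ∀* (2 + k) U-matrix

  realized : Fin (n G) → Formula k
  realized w = ∃' (tp G (extend w e) id)

  -- The vertex d is only the unit of the conjunction.
  E : Fin (n G) → Sentence
  E d = ∃* k (⋀ (realized d) realized)

  U-universal : Monoquantified qall U
  U-universal = ∀*-universal (2 + k) (qf U-matrix-QF)

  E-existential : ∀ d → Monoquantified qex (E d)
  E-existential d = ∃*-existential k (⋀-preserves (Monoquantified qex) conj (realized-∃ d) realized-∃)
    where
    realized-∃ : ∀ w → Monoquantified qex (realized w)
    realized-∃ w = ex (qf (tp-QF G (extend w e) id))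

  depth-U : depth U ≤ k + 2
  depth-U = ≤-reflexive (begin
    depth U              ≡⟨ depth-∀* (2 + k) U-matrix ⟩
    2 + k + depth U-matrix ≡⟨ cong (2 + k +_) (QF⇒depth≡0 U-matrix U-matrix-QF) ⟩
    2 + k + 0            ≡⟨ +-identityʳ (2 + k) ⟩
    2 + k                ≡⟨ +-comm 2 k ⟩
    k + 2                ∎)
    where open ≡-Reasoning

  depth-E : ∀ d → depth (E d) ≤ k + 2
  depth-E d = subst (_≤ k + 2) (sym (depth-∃* k _))
    (+-monoʳ-≤ k (m≤n⇒m≤1+n (⋀-preserves (λ φ → depth φ ≤ 1) ⊔-lub (depth-realized d) depth-realized)))
    where
    depth-realized : ∀ w → depth (realized w) ≤ 1
    depth-realized w = s≤s (≤-reflexive (QF⇒depth≡0 (tp G (extend w e) id) (tp-QF G (extend w e) id)))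

  module _ (H : Graph) where

    LiesOver : (Fin k → Fin (n H)) → Fin (n H) → Fin (n G) → Set
    LiesOver x y a = SameAtomicType H G (extend y x) (extend a e)

    PairsLieOver : (Fin k → Fin (n H)) → Set
    PairsLieOver x = ∀ y z → ∃₂ λ a b → SameAtomicType H G (extend z (extend y x)) (extend b (extend a e))

    RealizesAll : (Fin k → Fin (n H)) → Set
    RealizesAll x = ∀ w → ∃ λ z → LiesOver x z w

    ⊨U⇒PairsLieOver : H ⊨ U → ∀ {x} → SameAtomicType H G x e → PairsLieOver x
    ⊨U⇒PairsLieOver ⊨U {x} st y z =
      [ (λ ¬tp → ⊥-elim (¬tp (from (Sat-tp G e H τ x-vars) st))) ,
        (λ s → let (a , s′) = to (Sat-⋁⊥' H τ _) s ; (b , t) = to (Sat-⋁⊥' H τ _) s′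
               in a , b , to (Sat-tp G _ H τ id) t) ]
      (to (Sat-∀* H (2 + k) U-matrix) ⊨U τ)
      where
      τ : Fin (2 + k) → Fin (n H)
      τ = extend z (extend y x)

    ⊨E⇒RealizesAll : ∀ {d} → H ⊨ E d → ∃ RealizesAll
    ⊨E⇒RealizesAll ⊨E =
      let (x , s) = to (Sat-∃* H k _) ⊨E
      in x , λ w → let (z , t) = proj₂ (to (Sat-⋀ H x _ _) s) w in z , to (Sat-tp G _ H _ id) t

    RealizesAll⇒SameAtomicType : ∀ {x} → RealizesAll x → Fin (n G) → SameAtomicType H G x e
    RealizesAll⇒SameAtomicType realizes d = SameAtomicType-tail H G (proj₂ (realizes d))

    module _ (sieve : IsSieve G X) where

      LiesOver-unique : ∀ {x y a a′} → LiesOver x y a → LiesOver x y a′ → a ≡ a′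
      LiesOver-unique over over′ =
        sieve-separates G X sieve (SameAtomicType-trans G H G (SameAtomicType-sym H G over) over′)

      ≅G : ∀ {x} → PairsLieOver x → RealizesAll x → H ≅ G
      ≅G {x} pairs realizes = ↔⇒⤖ (mk↔ₛ′ f g f∘g g∘f) , adj-f
        where
        f : Fin (n H) → Fin (n G)
        f y = proj₁ (pairs y y)

        f-over : ∀ y → LiesOver x y (f y)
        f-over y = SameAtomicType-tail H G (proj₂ (proj₂ (pairs y y)))

        g : Fin (n G) → Fin (n H)
        g w = proj₁ (realizes w)

        f∘g : ∀ w → f (g w) ≡ w
        f∘g w = LiesOver-unique (f-over (g w)) (proj₂ (realizes w))

        -- U puts the pair (y , g (f y)) over a pair (a , b) with a = f y = b.
        g∘f : ∀ y → g (f y) ≡ y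
        g∘f y =
          let (a , b , st) = pairs y (g (f y))
              a≡fy = LiesOver-unique (SameAtomicType-tail H G st) (f-over y)
              b≡fy = LiesOver-unique (SameAtomicType-drop₁ H G st) (proj₂ (realizes (f y)))
          in from (proj₁ (st zero (suc zero))) (trans b≡fy (sym a≡fy))

        adj-f : ∀ u v → adj H u v ≡ adj G (f u) (f v)
        adj-f u v =
          let (a , b , st) = pairs u v
          in trans (proj₂ (st (suc zero) zero))
               (cong₂ (adj G) (LiesOver-unique (SameAtomicType-tail H G st) (f-over u))
                              (LiesOver-unique (SameAtomicType-drop₁ H G st) (f-over v)))

  G⊨U : ¬ Σ (Automorphism G X) (NonTrivial G X) → (∀ X′ → X′ ≢ X → ¬ InducedIso G X′ X) → G ⊨ U
  G⊨U rigid unique = from (Sat-∀* G (2 + k) U-matrix) λ τ →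
    case Sat? G τ (tp G e x-vars) (tp-QF G e x-vars) of λ where
      (no ¬tp) → inj₁ ¬tp
      (yes tp) → inj₂ (from (Sat-⋁⊥' G τ _) (τ (suc zero) , from (Sat-⋁⊥' G τ _) (τ zero ,
                   from (Sat-tp G _ G τ id) (≗⇒SameAtomicType G (τ-rigid τ (to (Sat-tp G e G τ x-vars) tp))))))
    where
    τ-rigid : ∀ τ → SameAtomicType G G (λ i → τ (suc (suc i))) e → τ ≗ extend (τ zero) (extend (τ (suc zero)) e)
    τ-rigid τ st zero = refl
    τ-rigid τ st (suc zero) = refl
    τ-rigid τ st (suc (suc i)) = enum-rigid G X rigid unique st i

  G⊨E : ∀ d → G ⊨ E d
  G⊨E d = from (Sat-∃* G k _) (e , from (Sat-⋀ G e _ _) (e-realizes d , e-realizes))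
    where
    e-realizes : ∀ w → Sat G e (realized w)
    e-realizes w = w , from (Sat-tp G _ G _ id) (≗⇒SameAtomicType G λ _ → refl)

defines : ∀ A G → G ⊨ A → (∀ H → H ⊨ A → H ≅ G) → Defines A G
defines A G G⊨A complete = G⊨A , λ H H≇G H⊨A → H≇G (complete H H⊨A)

lemma3p10 : (G : Graph) (X : Subset (n G)) →
    IsSieve G X →
    ¬ (Σ (Automorphism G X) (NonTrivial G X)) →
    (∀ (X' : Subset (n G)) → X' ≢ X → ¬ InducedIso G X' X) →
    D₀≤ G (∣ X ∣ + 2)
lemma3p10 G X sieve rigid unique with inhabited? (n G)
... | yes d =
  U ∧' E d ,
  (Monoquantified⇒NegQF U-universal , Monoquantified⇒NegQF (E-existential d)) ,
  cong₂ _⊔_ (Monoquantified⇒alternation≡0 U-universal) (Monoquantified⇒alternation≡0 (E-existential d)) ,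
  ⊔-lub depth-U (depth-E d) ,
  defines (U ∧' E d) G (G⊨U rigid unique , G⊨E d) λ H (⊨U , ⊨E) →
    let (x , realizes) = ⊨E⇒RealizesAll H ⊨E
    in ≅G H sieve (⊨U⇒PairsLieOver H ⊨U (RealizesAll⇒SameAtomicType H realizes d)) realizes
  where open DefiningSentence G X
... | no empty =
  -- G has no vertices: E would be false in G, and U alone already forces H ≅ G.
  U , Monoquantified⇒NegQF U-universal , Monoquantified⇒alternation≡0 U-universal , depth-U ,
  defines U G (G⊨U rigid unique) λ H ⊨U →
    ≅G H sieve {x H} (⊨U⇒PairsLieOver H ⊨U (λ i → ⊥-elim (empty (e i)))) (⊥-elim ∘ empty)
  where
  open DefiningSentence G X
  x : ∀ H → Fin k → Fin (n H)
  x H i = ⊥-elim (empty (e i))
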